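{- Let $k$ be a positive integer and let $G$ be a finite edge-minimal $k$-edge-connected multigraph. Let $G^k$ be the multigraph constructed from $G$ as described in the context. Then $G^k$ has at least two vertices and is exactly $k$-edge-connected.
   Context: Multigraphs may have parallel edges, and edge sets are multisets. A multigraph with at least two vertices is $k$-edge-connected if between any two distinct vertices there are $k$ pairwise edge-disjoint paths. It is edge-minimal $k$-edge-connected if it is $k$-edge-connected and, for every edge $e$, the graph $G-e$ is not $k$-edge-connected. It is exactly $k$-edge-connected if, for any two distinct vertices $u,v$, the maximum number of pairwise edge-disjoint $u$–$v$ paths is exactly $k$. For a positive integer $m$, the relation $R^m$ on $V(G)$ is defined by $v_1R^mv_2$ if and only if either $v_1=v_2$ or there are $m$ pairwise edge-disjoint $v_1$–$v_2$ paths in $G$; this is an equivalence relation. The multigraph $G^k$ has as vertex set the equivalence classes of $R^{k+1}$ on $G$. For each edge of $G$ with endpoints $u_1,u_2$, where $u_1$ lies in class $C_1$ and $u_2$ lies in class $C_2$, $G^k$ has one edge between $C_1$ and $C_2$. -}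

module Defs where

open import Data.Nat using (ℕ; zero; suc; _≤_)
open import Data.Fin using (Fin; punchIn)
open import Data.Product using (Σ; ∃; _×_; _,_; proj₁; proj₂)
open import Data.Sum using (_⊎_)
open import Data.List using (List; []; _∷_)
open import Data.List.Membership.Propositional using (_∈_)
open import Data.List.Relation.Unary.Unique.Propositional using (Unique)
open import Data.Empty using (⊥)
open import Relation.Nullary using (¬_)
open import Relation.Binary.PropositionalEquality using (_≡_; _≢_)
open import Function.Bundles using (_⇔_)

-- A finite multigraph with vertex set Fin n and edge set Fin m (a multiset of
-- edges: distinct edge indices may have the same endpoints; loops allowed).
-- Each edge is given by its (unordered, here stored as an ordered pair) endpoints.
Multigraph : ℕ → ℕ → Set
Multigraph n m = Fin m → Fin n × Fin n

module _ {n m : ℕ} (G : Multigraph n m) where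

  Joins : Fin m → Fin n → Fin n → Set
  Joins e u w = (G e ≡ (u , w)) ⊎ (G e ≡ (w , u))

  data Walk : Fin n → Fin n → Set where
    []   : ∀ {u} → Walk u u
    step : ∀ {u w v} (e : Fin m) → Joins e u w → Walk w v → Walk u v

  walkVertices : ∀ {u v} → Walk u v → List (Fin n)
  walkVertices {u} []           = u ∷ []
  walkVertices {u} (step e _ p) = u ∷ walkVertices p

  walkEdges : ∀ {u v} → Walk u v → List (Fin m)
  walkEdges []           = []
  walkEdges (step e _ p) = e ∷ walkEdges p

  Path : Fin n → Fin n → Set
  Path u v = Σ (Walk u v) λ p → Unique (walkVertices p)

  EdgeDisjoint : ∀ {u v} → Path u v → Path u v → Set
  EdgeDisjoint p q = ∀ e → e ∈ walkEdges (proj₁ p) → e ∈ walkEdges (proj₁ q) → ⊥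

  DisjointPaths : ℕ → Fin n → Fin n → Set
  DisjointPaths j u v =
    Σ (Fin j → Path u v) λ P → ∀ i i′ → i ≢ i′ → EdgeDisjoint (P i) (P i′)

  EdgeConnected : ℕ → Set
  EdgeConnected k = (2 ≤ n) × (∀ u v → u ≢ v → DisjointPaths k u v)

  ExactlyEdgeConnected : ℕ → Set
  ExactlyEdgeConnected k =
    ∀ u v → u ≢ v → DisjointPaths k u v × ¬ DisjointPaths (suc k) u v

  R : ℕ → Fin n → Fin n → Set
  R j u v = (u ≡ v) ⊎ DisjointPaths j u v

deleteEdge : ∀ {n m} → Multigraph n (suc m) → Fin (suc m) → Multigraph n m
deleteEdge G e f = G (punchIn e f)

EdgeMinimal : ℕ → ∀ {n m} → Multigraph n m → Set
EdgeMinimal k {m = zero}  G = EdgeConnected G k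
EdgeMinimal k {m = suc m} G =
  EdgeConnected G k × (∀ e → ¬ EdgeConnected (deleteEdge G e) k)

-- H (on vertex set Fin p, via the map q sending a vertex to its class) is G^k:
-- q is surjective, q identifies exactly the R^{k+1}-related vertices (so Fin p
-- is the set of R^{k+1}-classes), and each edge of G with endpoints u1,u2 gives
-- one edge of H between q u1 and q u2.
IsGk : ∀ {n m p} → ℕ → Multigraph n m → (Fin n → Fin p) → Multigraph p m → Set
IsGk {n} {m} {p} k G q H =
  (∀ c → ∃ λ u → q u ≡ c) ×
  (∀ u v → (q u ≡ q v) ⇔ R G (suc k) u v) ×
  (∀ e → H e ≡ (q (proj₁ (G e)) , q (proj₂ (G e))))

-- Mapping G onto G^k keeps every edge, so edge-disjoint paths of G become edge-disjoint walks of
-- G^k, and k-edge-connectivity of G gives k paths between any two classes. Conversely, vertices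
-- u, v in different classes are not joined by k+1 edge-disjoint paths, so by the edge form of
-- Menger's theorem (proved below with unit-capacity augmenting paths) a vertex set S separates
-- them with at most k edges of G crossing it. No class is split by S, as the k+1 edge-disjoint
-- paths inside a class would all cross S; so S descends to G^k, where it is crossed by the same
-- edges and leaves room for at most k edge-disjoint paths. Finally, if there were only one class,
-- every pair of vertices of G would be joined by k+1 edge-disjoint paths, so deleting any edge
-- would leave G k-edge-connected, against minimality.

module Submission where

open import Defs
open import Data.Nat using (ℕ; _≤_)
open import Data.Fin using (Fin)
open import Data.Product using (_×_)

open import Data.Bool using (Bool; true; false; not; _xor_)
open import Data.Bool.Properties using (xor-comm) renaming (_≟_ to _≟ᵇ_)
open import Data.Empty using (⊥; ⊥-elim)
open import Data.Fin as Fin using (zero; suc; punchIn; punchOut)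
open import Data.Fin.Properties
  using (any?; injective⇒≤; punchInᵢ≢i; punchIn-punchOut; punchIn-injective) renaming (_≟_ to _≟ᶠ_)
open import Data.List using (List; []; _∷_; length; map)
open import Data.List.Properties using (length-map)
open import Data.List.Membership.Propositional using (_∈_)
open import Data.List.Membership.Propositional.Properties using (∈-map⁺)
open import Data.List.Membership.Setoid.Properties using (index-injective)
open import Data.List.Relation.Binary.Subset.Propositional using (_⊆_)
open import Data.List.Relation.Unary.All as All using (All)
open import Data.List.Relation.Unary.All.Properties using (¬Any⇒All¬; All¬⇒¬Any)
open import Data.List.Relation.Unary.AllPairs using ([]; _∷_)
open import Data.List.Relation.Unary.Any as Any using (here; there; index)
open import Data.List.Relation.Unary.Unique.Propositional using (Unique)
open import Data.Maybe using (Maybe; just; nothing; is-just)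
open import Data.Nat using (zero; suc; _+_; _*_; _∸_; _<_; z≤n; s≤s)
open import Data.Nat.Induction using (<-wellFounded)
open import Data.Nat.Properties
open import Data.Nat.Tactic.RingSolver using (solve-∀)
open import Data.Product as Product using (Σ; ∃; ∃₂; _,_; proj₁; proj₂)
open import Data.Sum using (_⊎_; inj₁; inj₂) renaming (swap to ⊎-swap)
open import Data.Vec.Functional using (removeAt; updateAt)
open import Data.Vec.Functional.Properties using (updateAt-updates; updateAt-minimal)
open import Function using (_∘_; case_of_; Injective)
open import Function.Bundles using (Equivalence)
open import Induction.WellFounded using (Acc; acc)
open import Relation.Binary.PropositionalEquality
open import Relation.Nullary using (¬_; Dec; yes; no)
open import Relation.Nullary.Decidable using (_×-dec_; _⊎-dec_; map′)

open import Algebra.Properties.CommutativeMonoid.Sum +-0-commutativeMonoid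
  using (sum; sum-cong-≗; ∑-distrib-+; sum-remove)

-- Counting

⟦_⟧ : Bool → ℕ
⟦ true  ⟧ = 1
⟦ false ⟧ = 0

count : ∀ {m} → (Fin m → Bool) → ℕ
count P = sum (λ i → ⟦ P i ⟧)

sum-agree-except : ∀ {m} (g h : Fin m → ℕ) (e : Fin m) → (∀ i → i ≢ e → g i ≡ h i) →
             sum g + h e ≡ sum h + g e
sum-agree-except {suc m} g h e agree = begin
  sum g + h e                     ≡⟨ cong (_+ h e) (sum-remove {i = e} g) ⟩
  g e + sum (removeAt g e) + h e  ≡⟨ cong (λ s → g e + s + h e) (sum-cong-≗ agree-off-e) ⟩
  g e + sum (removeAt h e) + h e  ≡⟨ swap (g e) _ (h e) ⟩
  h e + sum (removeAt h e) + g e  ≡⟨ cong (_+ g e) (sym (sum-remove {i = e} h)) ⟩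
  sum h + g e                     ∎
  where
  open ≡-Reasoning
  agree-off-e : ∀ i → removeAt g e i ≡ removeAt h e i
  agree-off-e i = agree (punchIn e i) (punchInᵢ≢i e i)
  swap : ∀ a b c → a + b + c ≡ c + b + a
  swap = solve-∀

sum-positive : ∀ {m} (g : Fin m → ℕ) → 0 < sum g → ∃ λ i → 0 < g i
sum-positive {suc m} g pos with g zero in eq
... | suc _ = zero , subst (0 <_) (sym eq) (s≤s z≤n)
... | zero with sum-positive (g ∘ suc) pos
...   | i , gi>0 = suc i , gi>0

count≤ : ∀ {m} (P : Fin m → Bool) → count P ≤ m
count≤ {zero}  P = z≤n
count≤ {suc m} P = +-mono-≤ (⟦⟧≤1 (P zero)) (count≤ (P ∘ suc))
  where
  ⟦⟧≤1 : ∀ b → ⟦ b ⟧ ≤ 1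
  ⟦⟧≤1 true  = s≤s z≤n
  ⟦⟧≤1 false = z≤n

trueIndices : ∀ {m} → (Fin m → Bool) → List (Fin m)
trueIndices {zero}  P = []
trueIndices {suc m} P with P zero
... | true  = zero ∷ map suc (trueIndices (P ∘ suc))
... | false = map suc (trueIndices (P ∘ suc))

length-trueIndices : ∀ {m} (P : Fin m → Bool) → length (trueIndices P) ≡ count P
length-trueIndices {zero}  P = refl
length-trueIndices {suc m} P with P zero
... | true  = cong suc (trans (length-map Fin.suc (trueIndices (P ∘ suc))) (length-trueIndices (P ∘ suc)))
... | false = trans (length-map Fin.suc (trueIndices (P ∘ suc))) (length-trueIndices (P ∘ suc))

∈-trueIndices : ∀ {m} (P : Fin m → Bool) {e} → P e ≡ true → e ∈ trueIndices P
∈-trueIndices {suc m} P {zero} Pe with P zero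
... | true = here refl
∈-trueIndices {suc m} P {suc e} Pe with P zero
... | true  = there (∈-map⁺ suc (∈-trueIndices (P ∘ suc) Pe))
... | false = ∈-map⁺ suc (∈-trueIndices (P ∘ suc) Pe)

injective⇒≤count : ∀ {j m} (P : Fin m → Bool) (c : Fin j → Fin m) → Injective _≡_ _≡_ c →
                  (∀ i → P (c i) ≡ true) → j ≤ count P
injective⇒≤count P c c-injective Pc =
  subst (_ ≤_) (length-trueIndices P) (injective⇒≤ position-injective)
  where
  position : ∀ i → Fin (length (trueIndices P))
  position i = index (∈-trueIndices P (Pc i))
  position-injective : Injective _≡_ _≡_ position
  position-injective eq = c-injective
    (index-injective (setoid _) (∈-trueIndices P (Pc _)) (∈-trueIndices P (Pc _)) eq)

-- Walks, paths and cuts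

-- Walks along an arbitrary edge relation, so that residual walks of a flow are walks too.
data WalkIn {n m : ℕ} (A : Fin m → Fin n → Fin n → Set) : Fin n → Fin n → Set where
  []   : ∀ {u} → WalkIn A u u
  step : ∀ {u w v} (e : Fin m) → A e u w → WalkIn A w v → WalkIn A u v

module _ {n m : ℕ} {A : Fin m → Fin n → Fin n → Set} where

  vertices : ∀ {u v} → WalkIn A u v → List (Fin n)
  vertices {u} []           = u ∷ []
  vertices {u} (step e _ W) = u ∷ vertices W

  edges : ∀ {u v} → WalkIn A u v → List (Fin m)
  edges []           = []
  edges (step e _ W) = e ∷ edges W

  snoc : ∀ {u w v} → WalkIn A u w → (e : Fin m) → A e w v → WalkIn A u v
  snoc []            e r = step e r []
  snoc (step e′ r′ W) e r = step e′ r′ (snoc W e r)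

  start∈vertices : ∀ {u v} (W : WalkIn A u v) → u ∈ vertices W
  start∈vertices []           = here refl
  start∈vertices (step e _ W) = here refl

  PairwiseEdgeDisjoint : ∀ {j u v} → (Fin j → WalkIn A u v) → Set
  PairwiseEdgeDisjoint W = ∀ i i′ → i ≢ i′ → ∀ e → e ∈ edges (W i) → e ∈ edges (W i′) → ⊥

  SimpleWalk : Fin n → Fin n → Set
  SimpleWalk u v = Σ (WalkIn A u v) λ W → Unique (vertices W)

  suffixFrom : ∀ {u v x} (W : WalkIn A u v) → Unique (vertices W) → x ∈ vertices W →
               Σ (SimpleWalk x v) λ W′ → edges (proj₁ W′) ⊆ edges W
  suffixFrom []           unique (here refl) = ([] , unique) , λ ()
  suffixFrom (step e r W) unique (here refl) = (step e r W , unique) , λ e∈ → e∈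
  suffixFrom (step e r W) (_ ∷ unique) (there x∈W)
    with (W′ , W′⊆W) ← suffixFrom W unique x∈W = W′ , there ∘ W′⊆W

  removeCycles : ∀ {u v} (W : WalkIn A u v) → Σ (SimpleWalk u v) λ W′ → edges (proj₁ W′) ⊆ edges W
  removeCycles [] = ([] , All.[] ∷ []) , λ ()
  removeCycles {u} (step e r W)
    with ((W′ , unique) , W′⊆W) ← removeCycles W
    with Any.any? (u ≟ᶠ_) (vertices W′)
  ... | yes u∈W′ with (W″ , W″⊆W′) ← suffixFrom W′ unique u∈W′ = W″ , there ∘ W′⊆W ∘ W″⊆W′
  ... | no  u∉W′ = (step e r W′ , ¬Any⇒All¬ _ u∉W′ ∷ unique) , λ where
    (here refl) → here refl
    (there e∈W′) → there (W′⊆W e∈W′)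

joins-endpoint : ∀ {n m} {G : Multigraph n m} {e x y a b} →
                 Joins G e x y → Joins G e a b → x ≡ a ⊎ x ≡ b
joins-endpoint (inj₁ p) (inj₁ q) = inj₁ (cong proj₁ (trans (sym p) q))
joins-endpoint (inj₁ p) (inj₂ q) = inj₂ (cong proj₁ (trans (sym p) q))
joins-endpoint (inj₂ p) (inj₁ q) = inj₂ (cong proj₂ (trans (sym p) q))
joins-endpoint (inj₂ p) (inj₂ q) = inj₁ (cong proj₂ (trans (sym p) q))

module _ {n m : ℕ} {G : Multigraph n m} {A : Fin m → Fin n → Fin n → Set}
         (A⇒Joins : ∀ {e a b} → A e a b → Joins G e a b) where

  endpoint∈vertices : ∀ {u v e a b} (W : WalkIn A u v) → e ∈ edges W → Joins G e a b → a ∈ vertices W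
  endpoint∈vertices (step e r W) (here refl) e-ab with joins-endpoint {G = G} e-ab (A⇒Joins r)
  ... | inj₁ refl = here refl
  ... | inj₂ refl = there (start∈vertices W)
  endpoint∈vertices (step e r W) (there e∈W) e-ab = there (endpoint∈vertices W e∈W e-ab)

  simple⇒edge-unique : ∀ {u v} (W : WalkIn A u v) → Unique (vertices W) → Unique (edges W)
  simple⇒edge-unique []           _ = []
  simple⇒edge-unique (step e r W) (u∉W ∷ unique) =
    ¬Any⇒All¬ _ (λ e∈W → All¬⇒¬Any u∉W (endpoint∈vertices W e∈W (A⇒Joins r)))
    ∷ simple⇒edge-unique W unique

module _ {n m : ℕ} (G : Multigraph n m) where

  toWalk : ∀ {u v} → WalkIn (Joins G) u v → Walk G u v
  toWalk []           = []
  toWalk (step e r W) = step e r (toWalk W)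

  toWalk-vertices : ∀ {u v} (W : WalkIn (Joins G) u v) → walkVertices G (toWalk W) ≡ vertices W
  toWalk-vertices []           = refl
  toWalk-vertices (step e r W) = cong (_ ∷_) (toWalk-vertices W)

  toWalk-edges : ∀ {u v} (W : WalkIn (Joins G) u v) → walkEdges G (toWalk W) ≡ edges W
  toWalk-edges []           = refl
  toWalk-edges (step e r W) = cong (e ∷_) (toWalk-edges W)

  toPath : ∀ {u v} (W : WalkIn (Joins G) u v) → Σ (Path G u v) λ P → walkEdges G (proj₁ P) ⊆ edges W
  toPath W with ((W′ , unique) , W′⊆W) ← removeCycles W =
    (toWalk W′ , subst Unique (sym (toWalk-vertices W′)) unique) ,
    W′⊆W ∘ subst (_ ∈_) (toWalk-edges W′)

  walks⇒DisjointPaths : ∀ {j u v} (W : Fin j → WalkIn (Joins G) u v) → PairwiseEdgeDisjoint W →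
                        DisjointPaths G j u v
  walks⇒DisjointPaths W disjoint =
    (λ i → proj₁ (toPath (W i))) ,
    λ i i′ i≢i′ e e∈i e∈i′ → disjoint i i′ i≢i′ e (proj₂ (toPath (W i)) e∈i) (proj₂ (toPath (W i′)) e∈i′)

module _ {n m : ℕ} (G : Multigraph n m) where

  crosses : (Fin n → Bool) → Fin m → Bool
  crosses S e = S (proj₁ (G e)) xor S (proj₂ (G e))

  cutSize : (Fin n → Bool) → ℕ
  cutSize S = count (crosses S)

  cutSize-cong : ∀ {S T} → (∀ x → S x ≡ T x) → cutSize S ≡ cutSize T
  cutSize-cong S≗T = sum-cong-≗ {m} (λ e → cong ⟦_⟧ (cong₂ _xor_ (S≗T _) (S≗T _)))

  crosses-joins : ∀ S {e a b} → Joins G e a b → crosses S e ≡ S a xor S b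
  crosses-joins S (inj₁ G-ab) rewrite G-ab = refl
  crosses-joins S {a = a} {b} (inj₂ G-ba) rewrite G-ba = xor-comm (S b) (S a)

  crossing-edge : ∀ S {x y} (W : Walk G x y) → S x ≢ S y → ∃ λ e → e ∈ walkEdges G W × crosses S e ≡ true
  crossing-edge S []                        Sx≢Sy = ⊥-elim (Sx≢Sy refl)
  crossing-edge S {x} (step {w = w} e x-w W) Sx≢Sy with S x ≟ᵇ S w
  ... | no  Sx≢Sw = e , here refl , trans (crosses-joins S x-w) (xor-≢ Sx≢Sw)
    where
    xor-≢ : ∀ {a b} → a ≢ b → a xor b ≡ true
    xor-≢ {false} {false} ne = ⊥-elim (ne refl)
    xor-≢ {false} {true}  _  = refl
    xor-≢ {true}  {false} _  = refl
    xor-≢ {true}  {true}  ne = ⊥-elim (ne refl)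
  ... | yes Sx≡Sw with (e′ , e′∈W , crosses-e′) ← crossing-edge S W (Sx≢Sy ∘ trans Sx≡Sw) =
    e′ , there e′∈W , crosses-e′

  cut-bound : ∀ S {j u v} → S u ≢ S v → DisjointPaths G j u v → j ≤ cutSize S
  cut-bound S Su≢Sv (P , disjoint) = injective⇒≤count (crosses S) chosen chosen-injective (proj₂ ∘ proj₂ ∘ crossing)
    where
    crossing : ∀ i → ∃ λ e → e ∈ walkEdges G (proj₁ (P i)) × crosses S e ≡ true
    crossing i = crossing-edge S (proj₁ (P i)) Su≢Sv
    chosen : ∀ i → Fin m
    chosen = proj₁ ∘ crossing
    chosen-injective : Injective _≡_ _≡_ chosen
    chosen-injective {i} {i′} same with i ≟ᶠ i′
    ... | yes i≡i′ = i≡i′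
    ... | no  i≢i′ = ⊥-elim (disjoint i i′ i≢i′ (chosen i) (proj₁ (proj₂ (crossing i)))
                       (subst (_∈ walkEdges G (proj₁ (P i′))) (sym same) (proj₁ (proj₂ (crossing i′)))))

-- Menger's theorem

insert : ∀ {n} → (Fin n → Bool) → Fin n → Fin n → Bool
insert S x = updateAt S x (λ _ → true)

singleton : ∀ {n} → Fin n → Fin n → Bool
singleton = insert (λ _ → false)

module _ {n : ℕ} (S : Fin n → Bool) (x : Fin n) where

  insert-new : insert S x x ≡ true
  insert-new = updateAt-updates x S

  insert-old : ∀ {y} → y ≢ x → insert S x y ≡ S y
  insert-old y≢x = updateAt-minimal _ x S y≢x

  insert-cases : ∀ {y} → insert S x y ≡ true → y ≡ x ⊎ S y ≡ true
  insert-cases {y} Sy with y ≟ᶠ x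
  ... | yes y≡x = inj₁ y≡x
  ... | no  y≢x = inj₂ (trans (sym (insert-old y≢x)) Sy)

  insert-mono : ∀ {y} → S y ≡ true → insert S x y ≡ true
  insert-mono {y} Sy with y ≟ᶠ x
  ... | yes refl = insert-new
  ... | no  y≢x  = trans (insert-old y≢x) Sy

  count-insert : S x ≡ false → count (insert S x) ≡ suc (count S)
  count-insert Sx = begin
    count (insert S x)              ≡⟨ sym (+-identityʳ _) ⟩
    count (insert S x) + ⟦ false ⟧  ≡⟨ cong (λ b → count (insert S x) + ⟦ b ⟧) (sym Sx) ⟩
    count (insert S x) + ⟦ S x ⟧    ≡⟨ sum-agree-except _ _ x (λ y y≢x → cong ⟦_⟧ (insert-old y≢x)) ⟩
    count S + ⟦ insert S x x ⟧      ≡⟨ cong (λ b → count S + ⟦ b ⟧) insert-new ⟩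
    count S + 1                     ≡⟨ +-comm (count S) 1 ⟩
    suc (count S)                   ∎
    where open ≡-Reasoning

singleton-inv : ∀ {n} {x y : Fin n} → singleton x y ≡ true → y ≡ x
singleton-inv {x = x} Sy with insert-cases _ x Sy
... | inj₁ y≡x = y≡x

Closed : ∀ {n m} → (Fin m → Fin n → Fin n → Set) → (Fin n → Bool) → Set
Closed A S = ∀ {e a b} → A e a b → S a ≡ true → S b ≡ true

module _ {n m : ℕ} {A : Fin m → Fin n → Fin n → Set} (A? : ∀ e a b → Dec (A e a b)) where

  private
    Exit : (Fin n → Bool) → Set
    Exit S = ∃ λ a → ∃ λ b → ∃ λ e → S a ≡ true × S b ≡ false × A e a b

    exit? : ∀ S → Dec (Exit S)
    exit? S = any? λ a → any? λ b → any? λ e → (S a ≟ᵇ true) ×-dec ((S b ≟ᵇ false) ×-dec A? e a b)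

  reachOrSeparate : ∀ {u v} → u ≢ v →
    WalkIn A u v ⊎ Σ (Fin n → Bool) λ S → S u ≡ true × S v ≡ false × Closed A S
  reachOrSeparate {u} {v} u≢v =
    grow (singleton u) (<-wellFounded _) (insert-new _ u) (insert-old _ u (u≢v ∘ sym)) from-u
    where
    from-u : ∀ x → singleton u x ≡ true → WalkIn A u x
    from-u x ux with refl ← singleton-inv {x = u} {y = x} ux = []

    grow : ∀ S → Acc _<_ (n ∸ count S) → S u ≡ true → S v ≡ false → (∀ x → S x ≡ true → WalkIn A u x) →
           WalkIn A u v ⊎ Σ (Fin n → Bool) λ S → S u ≡ true × S v ≡ false × Closed A S
    grow S (acc smaller) Su Sv reach with exit? S
    ... | no no-exit = inj₂ (S , Su , Sv , closed)
      where
      closed : Closed A S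
      closed {e} {a} {b} r Sa with S b in Sb
      ... | true  = refl
      ... | false = ⊥-elim (no-exit (a , b , e , Sa , Sb , r))
    ... | yes (a , b , e , Sa , Sb , r) with b ≟ᶠ v
    ...   | yes refl = inj₁ (snoc (reach a Sa) e r)
    ...   | no  b≢v  =
      grow (insert S b) (smaller progress) (insert-mono S b Su) (trans (insert-old S b (b≢v ∘ sym)) Sv) reach′
      where
      progress : n ∸ count (insert S b) < n ∸ count S
      progress = ∸-monoʳ-< (≤-reflexive (sym (count-insert S b Sb))) (count≤ (insert S b))
      reach′ : ∀ x → insert S b x ≡ true → WalkIn A u x
      reach′ x Sx with insert-cases S b Sx
      ... | inj₁ refl = snoc (reach a Sa) e r
      ... | inj₂ Sx   = reach x Sx

module MaxFlow {n m : ℕ} (G : Multigraph n m) where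

  source target : Fin m → Bool → Fin n
  source e true  = proj₁ (G e)
  source e false = proj₂ (G e)
  target e d = source e (not d)

  source-target-joins : ∀ e d → Joins G e (source e d) (target e d)
  source-target-joins e true  = inj₁ refl
  source-target-joins e false = inj₂ refl

  -- f e ≡ just d: edge e carries one unit of flow from source e d to target e d.
  Flow : Set
  Flow = Fin m → Maybe Bool

  _[_≔_] : Flow → Fin m → Maybe Bool → Flow
  f [ e ≔ x ] = updateAt f e (λ _ → x)

  leaving entering : (Fin n → Bool) → Fin m → Maybe Bool → ℕ
  leaving  S e nothing  = 0
  leaving  S e (just d) = ⟦ S (source e d) ⟧
  entering S e nothing  = 0
  entering S e (just d) = ⟦ S (target e d) ⟧

  outflow inflow : Flow → (Fin n → Bool) → ℕ
  outflow f S = sum (λ e → leaving  S e (f e))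
  inflow  f S = sum (λ e → entering S e (f e))

  sum-update : (w : Fin m → Maybe Bool → ℕ) (f : Flow) (e : Fin m) {x₀ : Maybe Bool} (x : Maybe Bool) →
    f e ≡ x₀ → sum (λ i → w i ((f [ e ≔ x ]) i)) + w e x₀ ≡ sum (λ i → w i (f i)) + w e x
  sum-update w f e x refl =
    trans (sum-agree-except _ _ e (λ i i≢e → cong (w i) (updateAt-minimal i e f i≢e)))
          (cong (λ y → sum (λ i → w i (f i)) + w e y) (updateAt-updates e f))

  Demand : Set
  Demand = (Fin n → Bool) → ℕ

  infixr 5 _⊕_
  infix  6 _⊗_

  -- Prepending makes suc j ⊗ x and x ⊕ (j ⊗ x) definitionally equal.
  _⊕_ : Fin n → Demand → Demand
  (x ⊕ a) S = ⟦ S x ⟧ + a S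

  _⊗_ : ℕ → Fin n → Demand
  (j ⊗ x) S = j * ⟦ S x ⟧

  -- Conservation is required of every vertex set S at once: the flow leaving S minus the flow
  -- entering S is what the sources in S supply minus what the sinks in S absorb.
  Conserves : Flow → Demand → Demand → Set
  Conserves f src snk = ∀ S → outflow f S + snk S ≡ inflow f S + src S

  Conserves-shift : ∀ {f src snk} x → Conserves f src snk → Conserves f (x ⊕ src) (x ⊕ snk)
  Conserves-shift {f} {src} {snk} x c S =
    trans (exchange (outflow f S) ⟦ S x ⟧ (snk S))
          (trans (cong (⟦ S x ⟧ +_) (c S)) (sym (exchange (inflow f S) ⟦ S x ⟧ (src S))))
    where
    exchange : ∀ a b c → a + (b + c) ≡ b + (a + c)
    exchange = solve-∀

  Conserves-cancel : ∀ {f src snk} x → Conserves f (x ⊕ src) (x ⊕ snk) → Conserves f src snk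
  Conserves-cancel {f} {src} {snk} x c S = +-cancelˡ-≡ ⟦ S x ⟧ _ _
    (trans (exchange ⟦ S x ⟧ (outflow f S) (snk S)) (trans (c S) (exchange (inflow f S) ⟦ S x ⟧ (src S))))
    where
    exchange : ∀ a b c → a + (b + c) ≡ b + (a + c)
    exchange = solve-∀

  -- f′ carries one unit more than f from a to b; cancelling a unit from b to a counts as such.
  AddsUnit : Fin n → Fin n → Flow → Flow → Set
  AddsUnit a b f f′ = ∀ S → outflow f′ S + inflow f S + ⟦ S b ⟧ ≡ outflow f S + inflow f′ S + ⟦ S a ⟧

  AddsUnit-sink : ∀ {a b f f′ src snk} → AddsUnit a b f f′ →
                  Conserves f src (a ⊕ snk) → Conserves f′ src (b ⊕ snk)
  AddsUnit-sink {a} {b} {f} {f′} {src} {snk} adds c S = +-cancelʳ-≡ (inflow f S) _ _ (begin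
    outflow f′ S + (⟦ S b ⟧ + snk S) + inflow f S  ≡⟨ regroup (outflow f′ S) _ _ _ ⟩
    outflow f′ S + inflow f S + ⟦ S b ⟧ + snk S    ≡⟨ cong (_+ snk S) (adds S) ⟩
    outflow f S + inflow f′ S + ⟦ S a ⟧ + snk S    ≡⟨ regroup′ (outflow f S) _ _ _ ⟩
    outflow f S + (⟦ S a ⟧ + snk S) + inflow f′ S  ≡⟨ cong (_+ inflow f′ S) (c S) ⟩
    inflow f S + src S + inflow f′ S               ≡⟨ regroup″ (inflow f S) _ _ ⟩
    inflow f′ S + src S + inflow f S               ∎)
    where
    open ≡-Reasoning
    regroup : ∀ o b s i → o + (b + s) + i ≡ o + i + b + s
    regroup = solve-∀
    regroup′ : ∀ o i a s → o + i + a + s ≡ o + (a + s) + i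
    regroup′ = solve-∀
    regroup″ : ∀ i r i′ → i + r + i′ ≡ i′ + r + i
    regroup″ = solve-∀

  AddsUnit-source : ∀ {a b f f′ src snk} → AddsUnit a b f f′ →
                    Conserves f (b ⊕ src) snk → Conserves f′ (a ⊕ src) snk
  AddsUnit-source {a} {b} {f} {f′} {src} {snk} adds c S = +-cancelʳ-≡ (inflow f S + ⟦ S b ⟧) _ _ (begin
    outflow f′ S + snk S + (inflow f S + ⟦ S b ⟧)      ≡⟨ regroup (outflow f′ S) _ _ _ ⟩
    outflow f′ S + inflow f S + ⟦ S b ⟧ + snk S        ≡⟨ cong (_+ snk S) (adds S) ⟩
    outflow f S + inflow f′ S + ⟦ S a ⟧ + snk S        ≡⟨ regroup′ (outflow f S) _ _ _ ⟩
    outflow f S + snk S + (inflow f′ S + ⟦ S a ⟧)      ≡⟨ cong (_+ (inflow f′ S + ⟦ S a ⟧)) (c S) ⟩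
    inflow f S + (⟦ S b ⟧ + src S) + (inflow f′ S + ⟦ S a ⟧) ≡⟨ regroup″ (inflow f S) ⟦ S b ⟧ (src S) (inflow f′ S) ⟦ S a ⟧ ⟩
    inflow f′ S + (⟦ S a ⟧ + src S) + (inflow f S + ⟦ S b ⟧) ∎)
    where
    open ≡-Reasoning
    regroup : ∀ o s i b → o + s + (i + b) ≡ o + i + b + s
    regroup = solve-∀
    regroup′ : ∀ o i a s → o + i + a + s ≡ o + s + (i + a)
    regroup′ = solve-∀
    regroup″ : ∀ i b r i′ a → i + (b + r) + (i′ + a) ≡ i′ + (a + r) + (i + b)
    regroup″ = solve-∀

  update-AddsUnit : ∀ {f e x₀ a b} x → f e ≡ x₀ →
    (∀ S → leaving S e x + entering S e x₀ + ⟦ S b ⟧ ≡ leaving S e x₀ + entering S e x + ⟦ S a ⟧) →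
    AddsUnit a b f (f [ e ≔ x ])
  update-AddsUnit {f} {e} {x₀} {a} {b} x fe local S = +-cancelʳ-≡ (leaving S e x₀ + entering S e x) _ _ (begin
    O′ + I + ⟦ S b ⟧ + (l₀ + e₁)          ≡⟨ regroup O′ I _ l₀ e₁ ⟩
    (O′ + l₀) + (I + e₁) + ⟦ S b ⟧        ≡⟨ cong₂ (λ p q → p + q + ⟦ S b ⟧) out-update (sym in-update) ⟩
    (O + l₁) + (I′ + e₀) + ⟦ S b ⟧        ≡⟨ regroup′ O l₁ I′ e₀ _ ⟩
    O + I′ + (l₁ + e₀ + ⟦ S b ⟧)          ≡⟨ cong (O + I′ +_) (local S) ⟩
    O + I′ + (l₀ + e₁ + ⟦ S a ⟧)          ≡⟨ regroup″ O I′ l₀ e₁ _ ⟩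
    O + I′ + ⟦ S a ⟧ + (l₀ + e₁)          ∎)
    where
    open ≡-Reasoning
    O = outflow f S
    O′ = outflow (f [ e ≔ x ]) S
    I = inflow f S
    I′ = inflow (f [ e ≔ x ]) S
    l₀ = leaving S e x₀
    l₁ = leaving S e x
    e₀ = entering S e x₀
    e₁ = entering S e x
    out-update : O′ + l₀ ≡ O + l₁
    out-update = sum-update (leaving S) f e x fe
    in-update : I′ + e₀ ≡ I + e₁
    in-update = sum-update (entering S) f e x fe
    regroup : ∀ o i b l e → o + i + b + (l + e) ≡ (o + l) + (i + e) + b
    regroup = solve-∀
    regroup′ : ∀ o l i e b → (o + l) + (i + e) + b ≡ o + i + (l + e + b)
    regroup′ = solve-∀
    regroup″ : ∀ o i l e a → o + i + (l + e + a) ≡ o + i + a + (l + e)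
    regroup″ = solve-∀

  use-AddsUnit : ∀ {f e} d → f e ≡ nothing → AddsUnit (source e d) (target e d) f (f [ e ≔ just d ])
  use-AddsUnit d fe = update-AddsUnit (just d) fe (λ S → swap ⟦ S (source _ d) ⟧ ⟦ S (target _ d) ⟧)
    where
    swap : ∀ s t → s + 0 + t ≡ 0 + t + s
    swap = solve-∀

  remove-AddsUnit : ∀ {f e} d → f e ≡ just d → AddsUnit (target e d) (source e d) f (f [ e ≔ nothing ])
  remove-AddsUnit d fe = update-AddsUnit nothing fe (λ S → swap ⟦ S (source _ d) ⟧ ⟦ S (target _ d) ⟧)
    where
    swap : ∀ s t → 0 + t + s ≡ s + 0 + t
    swap = solve-∀

  ResidualAt : Maybe Bool → Fin m → Fin n → Fin n → Set
  ResidualAt nothing  e a b = ∃ λ d → source e d ≡ a × target e d ≡ b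
  ResidualAt (just d) e a b = target e d ≡ a × source e d ≡ b

  Residual : Flow → Fin m → Fin n → Fin n → Set
  Residual f e = ResidualAt (f e) e

  residual? : ∀ f e a b → Dec (Residual f e a b)
  residual? f e a b with f e
  ... | just d  = (target e d ≟ᶠ a) ×-dec (source e d ≟ᶠ b)
  ... | nothing = map′ (λ { (inj₁ p) → true , p ; (inj₂ p) → false , p })
                       (λ { (true , p) → inj₁ p ; (false , p) → inj₂ p })
                       (along true ⊎-dec along false)
    where
    along : ∀ d → Dec (source e d ≡ a × target e d ≡ b)
    along d = (source e d ≟ᶠ a) ×-dec (target e d ≟ᶠ b)

  residualAt-joins : ∀ x {e a b} → ResidualAt x e a b → Joins G e a b
  residualAt-joins nothing  (d , refl , refl) = source-target-joins _ d
  residualAt-joins (just d) (refl , refl)     = ⊎-swap (source-target-joins _ d)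

  residualAt-AddsUnit : ∀ {f e a b} x → f e ≡ x → ResidualAt x e a b →
                        ∃ λ x′ → AddsUnit a b f (f [ e ≔ x′ ])
  residualAt-AddsUnit nothing  fe (d , refl , refl) = just d , use-AddsUnit d fe
  residualAt-AddsUnit (just d) fe (refl , refl)     = nothing , remove-AddsUnit d fe

  -- W is residual for the original flow f₀; the flow f updated so far still agrees with f₀ on the
  -- rest of W because W repeats no edge.
  augment : ∀ {f₀ a b src snk} (W : WalkIn (Residual f₀) a b) → Unique (edges W) →
            ∀ f → (∀ {e} → e ∈ edges W → f e ≡ f₀ e) →
            Conserves f src (a ⊕ snk) → ∃ λ f′ → Conserves f′ src (b ⊕ snk)
  augment []                 _              f _     c = f , c
  augment {f₀} (step e r W) (e∉W ∷ unique) f agree c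
    with (x , adds) ← residualAt-AddsUnit {f} (f₀ e) (agree (here refl)) r =
    augment W unique (f [ e ≔ x ]) agree′ (AddsUnit-sink {f = f} {f′ = f [ e ≔ x ]} adds c)
    where
    agree′ : ∀ {e′} → e′ ∈ edges W → (f [ e ≔ x ]) e′ ≡ f₀ e′
    agree′ e′∈W = trans (updateAt-minimal _ e f (λ e′≡e → All.lookup e∉W e′∈W (sym e′≡e)))
                        (agree (there e′∈W))

  Closed⇒outflow≡cutSize+inflow : ∀ {f S} → Closed (Residual f) S → outflow f S ≡ cutSize G S + inflow f S
  Closed⇒outflow≡cutSize+inflow {f} {S} closed =
    trans (sum-cong-≗ {m} (λ e → edge-balance (f e) closed))
          (∑-distrib-+ (λ e → ⟦ crosses G S e ⟧) (λ e → entering S e (f e)))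
    where
    both-ways : ∀ a b → (a ≡ true → b ≡ true) → (b ≡ true → a ≡ true) → ⟦ a xor b ⟧ ≡ 0
    both-ways false false _  _  = refl
    both-ways false true  _  ba = case ba refl of λ ()
    both-ways true  false ab _  = case ab refl of λ ()
    both-ways true  true  _  _  = refl
    one-way : ∀ a b → (b ≡ true → a ≡ true) → ⟦ a ⟧ ≡ ⟦ a xor b ⟧ + ⟦ b ⟧
    one-way false false _  = refl
    one-way false true  ba = case ba refl of λ ()
    one-way true  false _  = refl
    one-way true  true  _  = refl
    edge-balance : ∀ {e} x → (∀ {a b} → ResidualAt x e a b → S a ≡ true → S b ≡ true) →
                   leaving S e x ≡ ⟦ crosses G S e ⟧ + entering S e x
    edge-balance {e} nothing closedₑ =
      sym (cong (_+ 0) (both-ways (S (source e true)) (S (source e false))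
                                  (closedₑ (true , refl , refl)) (closedₑ (false , refl , refl))))
    edge-balance {e} (just true) closedₑ = one-way (S (source e true)) (S (source e false)) (closedₑ (refl , refl))
    edge-balance {e} (just false) closedₑ =
      trans (one-way (S (source e false)) (S (source e true)) (closedₑ (refl , refl)))
            (cong (λ c → ⟦ c ⟧ + ⟦ S (source e true) ⟧) (xor-comm (S (source e false)) _))

  _≼_ : Flow → Flow → Set
  f′ ≼ f = ∀ e → f e ≡ nothing → f′ e ≡ nothing

  used : Flow → ℕ
  used f = count (λ e → is-just (f e))

  module _ {f : Flow} {e : Fin m} {d : Bool} (fe : f e ≡ just d) where

    remove-≼ : (f [ e ≔ nothing ]) ≼ f
    remove-≼ e′ fe′ with e′ ≟ᶠ e
    ... | yes refl = updateAt-updates e f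
    ... | no  e′≢e = trans (updateAt-minimal e′ e f e′≢e) fe′

    remove-used : used (f [ e ≔ nothing ]) < used f
    remove-used = ≤-reflexive (begin
      suc (used (f [ e ≔ nothing ]))  ≡⟨ +-comm 1 _ ⟩
      used (f [ e ≔ nothing ]) + 1    ≡⟨ sum-update (λ _ x → ⟦ is-just x ⟧) f e nothing fe ⟩
      used f + 0                      ≡⟨ +-identityʳ _ ⟩
      used f                          ∎)
      where open ≡-Reasoning

  outgoing-edge : ∀ f w → 0 < outflow f (singleton w) → ∃₂ λ e d → f e ≡ just d × source e d ≡ w
  outgoing-edge f w pos with sum-positive _ pos
  ... | e , leaves with f e in fe
  ...   | nothing = ⊥-elim (n≮0 leaves)
  ...   | just d  = e , d , fe , singleton-inv (⟦⟧-positive leaves)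
    where
    ⟦⟧-positive : ∀ {b} → 0 < ⟦ b ⟧ → b ≡ true
    ⟦⟧-positive {true} _ = refl

  source-leaves : ∀ {f w v src j} → w ≢ v → Conserves f (w ⊕ src) (v ⊕ j ⊗ v) → 0 < outflow f (singleton w)
  source-leaves {f} {w} {v} {src} {j} w≢v c = subst (0 <_) (sym (begin
    outflow f S                     ≡⟨ sym (+-identityʳ _) ⟩
    outflow f S + 0                 ≡⟨ cong (outflow f S +_) (sym sink-outside) ⟩
    outflow f S + (v ⊕ j ⊗ v) S     ≡⟨ c S ⟩
    inflow f S + (⟦ S w ⟧ + src S)  ≡⟨ cong (λ b → inflow f S + (⟦ b ⟧ + src S)) (insert-new _ w) ⟩
    inflow f S + suc (src S)        ∎)) (≤-trans (s≤s z≤n) (m≤n+m _ _))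
    where
    open ≡-Reasoning
    S = singleton w
    sink-outside : (v ⊕ j ⊗ v) S ≡ 0
    sink-outside rewrite insert-old (λ _ → false) w (w≢v ∘ sym) = *-zeroʳ j

  record Extraction (f : Flow) (w v : Fin n) (src snk : Demand) : Set where
    field
      rest      : Flow
      walk      : WalkIn (Joins G) w v
      conserves : Conserves rest src snk
      rest≼f    : rest ≼ f
      walk-used : ∀ {e} → e ∈ edges walk → f e ≢ nothing × rest e ≡ nothing

  -- Follow the flow out of w, deleting each edge as it is traversed, until the sink v is reached.
  extract : ∀ {f w v src j} → Acc _<_ (used f) →
            Conserves f (w ⊕ src) (v ⊕ j ⊗ v) → Extraction f w v src (j ⊗ v)
  extract {f} {w} {v} {src} {j} (acc smaller) c with w ≟ᶠ v
  ... | yes refl = record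
    { rest = f ; walk = [] ; conserves = Conserves-cancel {f = f} w c ; rest≼f = λ _ fe → fe ; walk-used = λ () }
  ... | no  w≢v with (e , d , fe , refl) ← outgoing-edge f w (source-leaves {f = f} {j = j} w≢v c) = record
    { rest      = rest
    ; walk      = step e (source-target-joins e d) walk
    ; conserves = conserves
    ; rest≼f    = λ e′ → rest≼f e′ ∘ remove-≼ fe e′
    ; walk-used = λ where
        (here refl)  → (λ fe′ → case trans (sym fe) fe′ of λ ()) , rest≼f e (updateAt-updates e f)
        (there e′∈W) → (λ fe′ → proj₁ (walk-used e′∈W) (remove-≼ fe _ fe′)) , proj₂ (walk-used e′∈W)
    }
    where
    open Extraction (extract {j = j} (smaller (remove-used fe))
                      (AddsUnit-source {f = f} {f′ = f [ e ≔ nothing ]} (remove-AddsUnit d fe) c))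

  module _ {u v : Fin n} where

    decompose : ∀ j {f} → Conserves f (j ⊗ u) (j ⊗ v) →
      Σ (Fin j → WalkIn (Joins G) u v) λ W → (∀ i {e} → e ∈ edges (W i) → f e ≢ nothing) × PairwiseEdgeDisjoint W
    decompose zero    c = (λ ()) , (λ ()) , (λ ())
    decompose (suc j) {f} c = walks , walks-used , walks-disjoint
      where
      open Extraction (extract {f} {j = j} (<-wellFounded _) c)
      others = decompose j conserves
      walks : Fin (suc j) → WalkIn (Joins G) u v
      walks zero    = walk
      walks (suc i) = proj₁ others i
      walks-used : ∀ i {e} → e ∈ edges (walks i) → f e ≢ nothing
      walks-used zero    e∈ = proj₁ (walk-used e∈)
      walks-used (suc i) e∈ = proj₁ (proj₂ others) i e∈ ∘ rest≼f _
      walks-disjoint : PairwiseEdgeDisjoint walks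
      walks-disjoint zero    zero     0≢0  = ⊥-elim (0≢0 refl)
      walks-disjoint zero    (suc i′) _    e e∈ e∈′ = proj₁ (proj₂ others) i′ e∈′ (proj₂ (walk-used e∈))
      walks-disjoint (suc i) zero     _    e e∈ e∈′ = proj₁ (proj₂ others) i e∈ (proj₂ (walk-used e∈′))
      walks-disjoint (suc i) (suc i′) i≢i′ = proj₂ (proj₂ others) i i′ (i≢i′ ∘ cong suc)

    module _ (u≢v : u ≢ v) where

      augmentOrCut : ∀ {j f} → Conserves f (j ⊗ u) (j ⊗ v) →
        (∃ λ f′ → Conserves f′ (suc j ⊗ u) (suc j ⊗ v)) ⊎ (∃ λ S → S u ≢ S v × cutSize G S ≡ j)
      augmentOrCut {j} {f} c with reachOrSeparate (residual? f) u≢v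
      ... | inj₁ W with ((W′ , simple) , _) ← removeCycles W =
        inj₁ (augment W′ (simple⇒edge-unique (λ {e} → residualAt-joins (f e)) W′ simple) f (λ _ → refl)
                      (Conserves-shift {f = f} u c))
      ... | inj₂ (S , Su , Sv , closed) =
        inj₂ (S , (λ Su≡Sv → case trans (sym Su) (trans Su≡Sv Sv) of λ ()) , cut≡j)
        where
        open ≡-Reasoning
        cut≡j : cutSize G S ≡ j
        cut≡j = +-cancelʳ-≡ (inflow f S) _ _ (begin
          cutSize G S + inflow f S     ≡⟨ sym (Closed⇒outflow≡cutSize+inflow closed) ⟩
          outflow f S                  ≡⟨ sym (+-identityʳ _) ⟩
          outflow f S + 0              ≡⟨ cong (outflow f S +_) (sym (*-zeroʳ j)) ⟩
          outflow f S + j * ⟦ false ⟧  ≡⟨ cong (λ b → outflow f S + j * ⟦ b ⟧) (sym Sv) ⟩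
          outflow f S + j * ⟦ S v ⟧    ≡⟨ c S ⟩
          inflow f S + j * ⟦ S u ⟧     ≡⟨ cong (λ b → inflow f S + j * ⟦ b ⟧) Su ⟩
          inflow f S + j * 1           ≡⟨ cong (inflow f S +_) (*-identityʳ j) ⟩
          inflow f S + j               ≡⟨ +-comm _ j ⟩
          j + inflow f S               ∎)

      flowOrCut : ∀ j → (∃ λ f → Conserves f (j ⊗ u) (j ⊗ v)) ⊎ (∃ λ S → S u ≢ S v × cutSize G S < j)
      flowOrCut zero = inj₁ ((λ _ → nothing) , λ S → refl)
      flowOrCut (suc j) with flowOrCut j
      ... | inj₂ (S , separates , small) = inj₂ (S , separates , m<n⇒m<1+n small)
      ... | inj₁ (f , c) with augmentOrCut {f = f} c
      ...   | inj₁ flow = inj₁ flow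
      ...   | inj₂ (S , separates , cut≡j) = inj₂ (S , separates , ≤-reflexive (cong suc cut≡j))

      menger : ∀ k → DisjointPaths G (suc k) u v ⊎ ∃ λ S → S u ≢ S v × cutSize G S ≤ k
      menger k with flowOrCut (suc k)
      ... | inj₁ (f , c) with (W , _ , disjoint) ← decompose (suc k) {f} c = inj₁ (walks⇒DisjointPaths G W disjoint)
      ... | inj₂ (S , separates , small) = inj₂ (S , separates , ≤-pred small)

open MaxFlow using (menger)

-- Images and edge deletion

IsImage : ∀ {n m p} → Multigraph n m → (Fin n → Fin p) → Multigraph p m → Set
IsImage G q H = ∀ e → H e ≡ (q (proj₁ (G e)) , q (proj₂ (G e)))

module _ {n m p : ℕ} {G : Multigraph n m} {q : Fin n → Fin p} {H : Multigraph p m}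
         (image : IsImage G q H) where

  image-joins : ∀ {e a b} → Joins G e a b → Joins H e (q a) (q b)
  image-joins {e} (inj₁ G-ab) = inj₁ (trans (image e) (cong (Product.map q q) G-ab))
  image-joins {e} (inj₂ G-ba) = inj₂ (trans (image e) (cong (Product.map q q) G-ba))

  image-walk : ∀ {a b} (W : Walk G a b) → Σ (WalkIn (Joins H) (q a) (q b)) λ W′ → edges W′ ≡ walkEdges G W
  image-walk []           = [] , refl
  image-walk (step e r W) with (W′ , same-edges) ← image-walk W = step e (image-joins r) W′ , cong (e ∷_) same-edges

  image-DisjointPaths : ∀ {j a b} → DisjointPaths G j a b → DisjointPaths H j (q a) (q b)
  image-DisjointPaths (P , disjoint) = walks⇒DisjointPaths H (proj₁ ∘ image-walk′) λ i i′ i≢i′ e e∈ e∈′ →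
    disjoint i i′ i≢i′ e (subst (e ∈_) (proj₂ (image-walk′ i)) e∈) (subst (e ∈_) (proj₂ (image-walk′ i′)) e∈′)
    where
    image-walk′ = λ i → image-walk (proj₁ (P i))

  cutSize-image : ∀ T → cutSize H T ≡ cutSize G (T ∘ q)
  cutSize-image T = sum-cong-≗ {m} (λ e → cong (λ ends → ⟦ T (proj₁ ends) xor T (proj₂ ends) ⟧) (image e))

  image-cut-bound : ∀ (T : Fin p → Bool) {j C D} → T C ≢ T D → DisjointPaths H j C D → j ≤ cutSize G (T ∘ q)
  image-cut-bound T TC≢TD paths = subst (_ ≤_) (cutSize-image T) (cut-bound H T TC≢TD paths)

module _ {n m : ℕ} (G : Multigraph n (suc m)) (e : Fin (suc m)) where

  avoid : ∀ {a b} (W : Walk G a b) → ¬ e ∈ walkEdges G W →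
    Σ (Walk (deleteEdge G e) a b) λ W′ → walkVertices _ W′ ≡ walkVertices G W ×
      (∀ {f} → f ∈ walkEdges _ W′ → punchIn e f ∈ walkEdges G W)
  avoid []                     _   = [] , refl , λ ()
  avoid {a} (step e′ a-w W) e∉ with (W′ , same-vertices , edges-lift) ← avoid W (e∉ ∘ there) =
    step (punchOut e≢e′) (subst (λ f → Joins G f _ _) (sym (punchIn-punchOut e≢e′)) a-w) W′ ,
    cong (a ∷_) same-vertices ,
    λ where
      (here refl) → here (punchIn-punchOut e≢e′)
      (there f∈W′) → there (edges-lift f∈W′)
    where
    e≢e′ : e ≢ e′
    e≢e′ = e∉ ∘ here

  -- Among edge-disjoint paths at most one uses e; drop that one (or an arbitrary one) and keep the rest.
  deleteEdge-DisjointPaths : ∀ {k x y} → DisjointPaths G (suc k) x y → DisjointPaths (deleteEdge G e) k x y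
  deleteEdge-DisjointPaths {k} (P , disjoint) = P′ , λ i i′ i≢i′ f f∈ f∈′ →
    disjoint (punchIn dropped i) (punchIn dropped i′) (i≢i′ ∘ punchIn-injective dropped i i′)
             (punchIn e f) (proj₂ (proj₂ (kept i)) f∈) (proj₂ (proj₂ (kept i′)) f∈′)
    where
    dropping : Σ (Fin (suc k)) λ i₀ → ∀ i → i ≢ i₀ → ¬ e ∈ walkEdges G (proj₁ (P i))
    dropping with any? (λ i → Any.any? (e ≟ᶠ_) (walkEdges G (proj₁ (P i))))
    ... | yes (i₀ , e∈i₀) = i₀ , λ i i≢i₀ e∈i → disjoint i i₀ i≢i₀ e e∈i e∈i₀
    ... | no  unused      = zero , λ i _ e∈i → unused (i , e∈i)
    dropped = proj₁ dropping
    kept = λ i → avoid (proj₁ (P (punchIn dropped i))) (proj₂ dropping _ (punchInᵢ≢i dropped i))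
    P′ : Fin k → Path (deleteEdge G e) _ _
    P′ i = proj₁ (kept i) , subst Unique (sym (proj₁ (proj₂ (kept i)))) (proj₂ (P (punchIn dropped i)))

-- Edge-minimal graphs and G^k

EdgeMinimal⇒EdgeConnected : ∀ {k n m} (G : Multigraph n m) → EdgeMinimal k G → EdgeConnected G k
EdgeMinimal⇒EdgeConnected {m = zero}  G minimal = minimal
EdgeMinimal⇒EdgeConnected {m = suc m} G minimal = proj₁ minimal

edgeless-disconnected : ∀ {k n} (G : Multigraph n 0) → 1 ≤ k → ¬ EdgeConnected G k
edgeless-disconnected {suc k} {suc zero}    G _ (s≤s () , _)
edgeless-disconnected {suc k} {suc (suc n)} G _ (_ , connected)
  with step () _ _ ← proj₁ (proj₁ (connected zero (suc zero) (λ ())) zero)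

EdgeMinimal⇒¬uniformly-connected : ∀ {k n m} (G : Multigraph n m) → 1 ≤ k → EdgeMinimal k G →
  ¬ (∀ x y → x ≢ y → DisjointPaths G (suc k) x y)
EdgeMinimal⇒¬uniformly-connected {m = zero}  G 1≤k minimal _ = edgeless-disconnected G 1≤k minimal
EdgeMinimal⇒¬uniformly-connected {m = suc m} G 1≤k (connected , minimal) more-connected =
  minimal zero (proj₁ connected , λ x y x≢y → deleteEdge-DisjointPaths G zero (more-connected x y x≢y))

EdgeMinimal⇒two-classes : ∀ {k n m p} (G : Multigraph n m) → 1 ≤ k → EdgeMinimal k G →
  (q : Fin n → Fin p) → (∀ x y → q x ≡ q y → R G (suc k) x y) → 2 ≤ p
EdgeMinimal⇒two-classes {p = p} G 1≤k minimal q same-class⇒R with 2 ≤? p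
... | yes 2≤p = 2≤p
... | no  2≰p = ⊥-elim (EdgeMinimal⇒¬uniformly-connected G 1≤k minimal λ x y x≢y →
                  distinct x≢y (same-class⇒R x y (one-class 2≰p (q x) (q y))))
  where
  distinct : ∀ {x y} → x ≢ y → R G (suc _) x y → DisjointPaths G (suc _) x y
  distinct x≢y (inj₁ x≡y) = ⊥-elim (x≢y x≡y)
  distinct _   (inj₂ paths) = paths
  one-class : ∀ {p} → ¬ 2 ≤ p → (a b : Fin p) → a ≡ b
  one-class {suc zero}    _   zero zero = refl
  one-class {suc (suc p)} 2≰p _    _    = ⊥-elim (2≰p (s≤s (s≤s z≤n)))

small-cut-respects-R : ∀ {n m k} (G : Multigraph n m) (S : Fin n → Bool) → cutSize G S ≤ k →
  ∀ {x y} → R G (suc k) x y → S x ≡ S y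
small-cut-respects-R G S small (inj₁ refl) = refl
small-cut-respects-R G S small {x} {y} (inj₂ paths) with S x ≟ᵇ S y
... | yes Sx≡Sy = Sx≡Sy
... | no  Sx≢Sy = ⊥-elim (1+n≰n (≤-trans (cut-bound G S Sx≢Sy paths) small))

proposition9 : (k : ℕ) → 1 ≤ k → (n m : ℕ) (G : Multigraph n m) → EdgeMinimal k G →
    (p : ℕ) (q : Fin n → Fin p) (H : Multigraph p m) → IsGk k G q H →
    (2 ≤ p) × ExactlyEdgeConnected H k
proposition9 k 1≤k n m G minimal p q H (q-onto , classes , image) =
  EdgeMinimal⇒two-classes G 1≤k minimal q (λ x y → Equivalence.to (classes x y)) , exact
  where
  rep : Fin p → Fin n
  rep c = proj₁ (q-onto c)
  exact : ExactlyEdgeConnected H k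
  exact C D C≢D = at-least-k , ¬k+1
    where
    same-class : q (rep C) ≡ q (rep D) → C ≡ D
    same-class eq = trans (sym (proj₂ (q-onto C))) (trans eq (proj₂ (q-onto D)))
    u≢v : rep C ≢ rep D
    u≢v = C≢D ∘ same-class ∘ cong q
    at-least-k : DisjointPaths H k C D
    at-least-k = subst₂ (DisjointPaths H k) (proj₂ (q-onto C)) (proj₂ (q-onto D))
      (image-DisjointPaths {q = q} image (proj₂ (EdgeMinimal⇒EdgeConnected G minimal) _ _ u≢v))
    ¬k+1 : ¬ DisjointPaths H (suc k) C D
    ¬k+1 paths with menger G u≢v k
    ... | inj₁ paths-in-G = C≢D (same-class (Equivalence.from (classes _ _) (inj₂ paths-in-G)))
    ... | inj₂ (S , separates , small) = 1+n≰n (begin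
      suc k                    ≤⟨ image-cut-bound {q = q} image (S ∘ rep) separates paths ⟩
      cutSize G (S ∘ rep ∘ q)  ≡⟨ cutSize-cong G constant-on-classes ⟩
      cutSize G S              ≤⟨ small ⟩
      k                        ∎)
      where
      open ≤-Reasoning
      constant-on-classes : ∀ x → S (rep (q x)) ≡ S x
      constant-on-classes x = small-cut-respects-R G S small (Equivalence.to (classes _ x) (proj₂ (q-onto (q x))))
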